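{- Let $q$ be a prime power with $q\equiv 1\pmod 4$ and $q\not\equiv 1\pmod 3$. For every $x\in\mathbb{F}_{q^3}^*$, $\kappa_{\mathrm{i}}(x)=\kappa_{ -\mathrm{i}}(x)$.
   Context: $\mathbb{E}=\mathbb{F}_{q^3}$, $\mathrm{T}(x)=x+x^q+x^{q^2}$. Fix a primitive element $\alpha$ of $\mathbb{E}$ and put $\mu=\alpha^{q-1}$. The quartic character $\chi_4$ of $\mathbb{E}$ is defined by $\chi_4(0)=0$, $\chi_4(\alpha^n)=\mathrm{i}^n$ with $\mathrm{i}=\sqrt{ -1}$; $\overline{\chi_4}$ is its complex conjugate. For $z\in\{1,\mathrm{i},-1,-\mathrm{i}\}$ and $x\in\mathbb{E}^*$, $\kappa_z(x)$ is the number of $i$ with $0\le i<q^2+q+1$ such that $\chi_4(\mathrm{T}(\mu^ix))\,\overline{\chi_4}(\mathrm{T}(\mu^{ -i}x))=z$. -}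

module Defs where

open import Level using (Level; _⊔_) renaming (suc to lsuc)
open import Data.Nat using (ℕ; zero; suc; _∸_; _^_; _≤_; _%_)
open import Data.Nat.Primality using (Prime)
open import Data.Fin using (Fin)
open import Data.Product using (∃; _×_; Σ-syntax)
open import Data.Maybe using (Maybe; just; nothing; _>>=_)
open import Data.List using (List; upTo; head; length; filterᵇ)
open import Relation.Nullary using (¬_)
open import Relation.Nullary.Decidable using (⌊_⌋)
open import Relation.Binary using (Decidable)
open import Relation.Binary.PropositionalEquality using (_≡_)
open import Algebra.Bundles using (CommutativeRing)
import Data.Nat as ℕ
open import Data.Maybe.Properties using (≡-dec)

IsPrimePower : ℕ → Set
IsPrimePower q = ∃ λ p → ∃ λ e → Prime p × 1 ≤ e × q ≡ p ^ e

record FiniteField (c ℓ : Level) : Set (lsuc (c ⊔ ℓ)) where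
  field
    commRing : CommutativeRing c ℓ
  open CommutativeRing commRing public
  field
    _≟_      : Decidable _≈_
    0≉1      : ¬ (0# ≈ 1#)
    inverse  : ∀ x → ¬ (x ≈ 0#) → ∃ λ y → x * y ≈ 1#
    size     : ℕ
    enum     : Fin size → Carrier
    enum-surj : ∀ x → ∃ λ i → enum i ≈ x
    enum-inj  : ∀ i j → enum i ≈ enum j → i ≡ j

module _ {c ℓ : Level} (F : FiniteField c ℓ) where
  open FiniteField F

  pow : Carrier → ℕ → Carrier
  pow x zero    = 1#
  pow x (suc n) = x * pow x n

  IsPrimitive : Carrier → Set (c ⊔ ℓ)
  IsPrimitive α = ∀ x → ¬ (x ≈ 0#) → ∃ λ n → pow α n ≈ x

  module Quartic (q : ℕ) (α : Carrier) where
    Tr : Carrier → Carrier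
    Tr x = x + pow x q + pow x (q ^ 2)

    -- discrete logarithm to base α: least n < size - 1 with α^n = a (nothing for a = 0)
    dlog : Carrier → Maybe ℕ
    dlog a = head (filterᵇ (λ n → ⌊ pow α n ≟ a ⌋) (upTo (size ∸ 1)))

    -- quartic character, encoded by the exponent k ∈ {0,1,2,3} with χ₄(a) = i^k;
    -- nothing encodes χ₄(0) = 0
    chi4 : Carrier → Maybe ℕ
    chi4 a = dlog a >>= λ n → just (n % 4)

    μ : Carrier
    μ = pow α (q ∸ 1)

    N : ℕ
    N = (q ^ 2 ℕ.+ q) ℕ.+ 1

    -- μ^{-i}, written as μ^{N - i} (μ has order dividing N)
    μinv : ℕ → Carrier
    μinv i = pow μ (N ∸ i)

    -- exponent of χ₄(T(μ^i x)) · conj(χ₄(T(μ^{-i} x))) = i^{a-b}; nothing if it is 0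
    prodExp : Carrier → ℕ → Maybe ℕ
    prodExp x i = chi4 (Tr (pow μ i * x)) >>= λ a →
                  chi4 (Tr (μinv i * x)) >>= λ b →
                  just (((a ℕ.+ 4) ∸ b) % 4)

    -- κ_z(x) for z = i^k
    kappa : ℕ → Carrier → ℕ
    kappa k x = length (filterᵇ (λ i → ⌊ ≡-dec ℕ._≟_ (prodExp x i) (just k) ⌋) (upTo N))

module Submission where

-- The statement κ_i(x) = κ_{-i}(x) is a
-- symmetry of the index set ℤ/N: replacing i by -i swaps the two factors of
--   χ₄(T(μ^i x)) · conj χ₄(T(μ^{-i} x)),
-- so the value at -i is the complex conjugate of the value at i, and the value
-- i at one index corresponds to -i at the reflected one.  In the encoding used
-- by the definitions the index set is 0, …, N-1 and μ^{-i} is μ^(N-i); the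
-- reflection i ↦ N - i pairs up 1, …, N-1, while i = 0 is a fixed point because
-- μ^N = α^(q³-1) = 1 by Fermat's little theorem, so its value is 1 and it
-- contributes to neither count.

open import Defs
open import Level using (Level)
open import Data.Nat using (ℕ; _^_; _%_)
open import Relation.Nullary using (¬_)
open import Relation.Binary.PropositionalEquality using (_≡_)

open import Data.Nat as ℕ using (zero; suc; _+_; _∸_; _<_; _≤_; z≤n; s≤s; NonZero; >-nonZero)
open import Data.Nat.Properties as ℕₚ using (+-comm; +-assoc; +-∸-assoc; m+n∸m≡n; allUpTo?; m∸[m∸n]≡n;
  n<1+n; m∸n≤m; m+[n∸m]≡n; m<n⇒0<n∸m; ≤-antisym; ≤-trans; ≤-pred; <⇒≤; ≤⇒≯; ^-monoˡ-≤)
open import Data.Nat.DivMod using (_/_; m%n<n; m≡m%n+[m/n]*n)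
open import Data.Nat.Solver using (module +-*-Solver)
open import Data.Bool using (Bool; true; false; T?)
import Data.Bool.Properties as Bool
open import Data.Maybe using (Maybe; just; nothing; _>>=_)
open import Data.Maybe.Properties using (≡-dec)
open import Data.List using (length; filterᵇ; applyUpTo; upTo; head)
open import Data.List.Properties using (filter-≐)
open import Data.Fin using (Fin; toℕ; fromℕ<; punchIn; punchOut)
open import Data.Fin.Properties using (pigeonhole; injective⇒≤; fromℕ<-injective; punchIn-punchOut; punchInᵢ≢i; punchIn-injective; toℕ<n)
open import Data.Product using (∃; _,_; proj₁; proj₂; _×_)
open import Data.Empty using (⊥-elim)
open import Function using (_∘_; id)
open import Function.Definitions using (Injective)
open import Relation.Nullary.Decidable using (⌊_⌋; from-yes; True; toWitness; fromWitness)
open import Relation.Binary.PropositionalEquality as ≡ using (_≢_; refl; cong; cong₂)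

ind : Bool → ℕ
ind true  = 1
ind false = 0

count : (ℕ → Bool) → ℕ → ℕ
count p zero    = 0
count p (suc n) = ind (p 0) + count (p ∘ suc) n

count-filter : ∀ (p : ℕ → Bool) f n → length (filterᵇ p (applyUpTo f n)) ≡ count (p ∘ f) n
count-filter p f zero = refl
count-filter p f (suc n) with p (f 0)
... | true  = cong suc (count-filter p (f ∘ suc) n)
... | false = count-filter p (f ∘ suc) n

count-cong : ∀ {p q : ℕ → Bool} n → (∀ {i} → i < n → p i ≡ q i) → count p n ≡ count q n
count-cong zero    eq = refl
count-cong (suc n) eq = cong₂ _+_ (cong ind (eq (s≤s z≤n))) (count-cong n (eq ∘ s≤s))

count-snoc : ∀ (p : ℕ → Bool) n → count p (suc n) ≡ count p n + ind (p n)
count-snoc p zero    = +-comm (ind (p 0)) 0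
count-snoc p (suc n) = ≡.trans (cong (ind (p 0) +_) (count-snoc (p ∘ suc) n))
                             (≡.sym (+-assoc (ind (p 0)) _ _))

count-reverse : ∀ (p : ℕ → Bool) n → count p n ≡ count (λ i → p (n ∸ suc i)) n
count-reverse p zero    = refl
count-reverse p (suc n) = ≡.trans (count-snoc p n)
  (≡.trans (+-comm (count p n) (ind (p n))) (cong (ind (p n) +_) (count-reverse p n)))

-- This is the involution
-- i ↦ -i of ℤ/n, whose only fixed point in the range taken into account is 0.
count-reflect : ∀ {p q : ℕ → Bool} n → p 0 ≡ q 0 →
  (∀ {i} → 0 < i → i < n → p (n ∸ i) ≡ q i) → count p n ≡ count q n
count-reflect zero    eq₀ eq = refl
count-reflect {p} {q} (suc m) eq₀ eq = cong₂ _+_ (cong ind eq₀) (begin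
    count (p ∘ suc) m                        ≡⟨ count-reverse (p ∘ suc) m ⟩
    count (λ j → p (suc (m ∸ suc j))) m      ≡⟨ count-cong m reflected ⟩
    count (q ∘ suc) m                        ∎)
  where
  open ≡.≡-Reasoning
  reflected : ∀ {j} → j < m → p (suc (m ∸ suc j)) ≡ q (suc j)
  reflected {j} j<m = ≡.trans (cong p (≡.sym (+-∸-assoc 1 j<m))) (eq (s≤s z≤n) (s≤s j<m))

-- A value of χ₄ (or of a product of such values) is encoded as the exponent k
-- of i, with nothing for 0; isExp k u tests whether u encodes i^k.
isExp : ℕ → Maybe ℕ → Bool
isExp k u = ⌊ ≡-dec ℕ._≟_ u (just k) ⌋

reduce : Maybe ℕ → Maybe ℕ
reduce m = m >>= λ n → just (n % 4)

quotExp : Maybe ℕ → Maybe ℕ → Maybe ℕ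
quotExp u v = u >>= λ a → v >>= λ b → just (((a + 4) ∸ b) % 4)

conj-exp : ∀ {a} → a < 4 → ∀ {b} → b < 4 →
  isExp 1 (quotExp (just b) (just a)) ≡ isExp 3 (quotExp (just a) (just b))
conj-exp = from-yes (allUpTo? (λ a → allUpTo? (λ b →
  isExp 1 (quotExp (just b) (just a)) Bool.≟ isExp 3 (quotExp (just a) (just b))) 4) 4)

quotExp-conj : ∀ m m' → isExp 1 (quotExp (reduce m') (reduce m)) ≡ isExp 3 (quotExp (reduce m) (reduce m'))
quotExp-conj nothing  nothing   = refl
quotExp-conj nothing  (just _)  = refl
quotExp-conj (just _) nothing   = refl
quotExp-conj (just n) (just n') = conj-exp (m%n<n n 4) (m%n<n n' 4)

-- χ₄(a) · conj χ₄(a) is 0 or 1, never i^k for k = 1, 2, 3.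
quotExp-self : ∀ k m → isExp (suc k) (quotExp (reduce m) (reduce m)) ≡ false
quotExp-self k nothing  = refl
quotExp-self k (just n) rewrite m+n∸m≡n (n % 4) 4 = refl

module FieldPowers {c ℓ : Level} (F : FiniteField c ℓ) where
  open FiniteField F renaming (refl to ≈-refl)
  open import Algebra.Properties.Monoid.Mult *-monoid renaming (_×_ to _·_) using (×-congʳ; ×-homo-+; ×-assocˡ)
  open import Relation.Binary.Reasoning.Setoid setoid

  -- pow is the power operation of the multiplicative monoid, so its laws come from the library
  pow≡· : ∀ x n → pow F x n ≡ n · x
  pow≡· x zero    = ≡.refl
  pow≡· x (suc n) = cong (x *_) (pow≡· x n)

  pow-cong : ∀ {a b} n → a ≈ b → pow F a n ≈ pow F b n
  pow-cong {a} {b} n a≈b rewrite pow≡· a n | pow≡· b n = ×-congʳ n a≈b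

  pow-+ : ∀ a m n → pow F a (m ℕ.+ n) ≈ pow F a m * pow F a n
  pow-+ a m n rewrite pow≡· a (m ℕ.+ n) | pow≡· a m | pow≡· a n = ×-homo-+ a m n

  pow-* : ∀ a m n → pow F (pow F a m) n ≈ pow F a (m ℕ.* n)
  pow-* a m n rewrite pow≡· (pow F a m) n | pow≡· a m | pow≡· a (m ℕ.* n) | ℕₚ.*-comm m n = ×-assocˡ a n m

  pow-one : ∀ n → pow F 1# n ≈ 1#
  pow-one zero    = ≈-refl
  pow-one (suc n) = trans (*-identityˡ _) (pow-one n)

  cancelˡ : ∀ {c a b} → ¬ c ≈ 0# → c * a ≈ c * b → a ≈ b
  cancelˡ {c} {a} {b} c≉0 ca≈cb with inverse c c≉0
  ... | y , cy≈1 = begin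
      a            ≈⟨ sym (undo a) ⟩
      y * (c * a)  ≈⟨ *-cong ≈-refl ca≈cb ⟩
      y * (c * b)  ≈⟨ undo b ⟩
      b            ∎
    where
    undo : ∀ z → y * (c * z) ≈ z
    undo z = trans (sym (*-assoc y c z)) (trans (*-cong (trans (*-comm y c) cy≈1) ≈-refl) (*-identityˡ z))

  nonzero-* : ∀ {a b} → ¬ a ≈ 0# → ¬ b ≈ 0# → ¬ a * b ≈ 0#
  nonzero-* {a} a≉0 b≉0 ab≈0 = b≉0 (cancelˡ a≉0 (trans ab≈0 (sym (zeroʳ a))))

  module Primitive (α : Carrier) (prim : IsPrimitive F α) where

    pow-mod : ∀ d .{{_ : NonZero d}} → pow F α d ≈ 1# → ∀ k → pow F α k ≈ pow F α (k % d)
    pow-mod d αᵈ≈1 k = begin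
      pow F α k                                    ≡⟨ cong (pow F α) division ⟩
      pow F α (k % d ℕ.+ d ℕ.* (k / d))            ≈⟨ pow-+ α (k % d) (d ℕ.* (k / d)) ⟩
      pow F α (k % d) * pow F α (d ℕ.* (k / d))    ≈⟨ *-cong ≈-refl (sym (pow-* α d (k / d))) ⟩
      pow F α (k % d) * pow F (pow F α d) (k / d)  ≈⟨ *-cong ≈-refl (trans (pow-cong (k / d) αᵈ≈1) (pow-one (k / d))) ⟩
      pow F α (k % d) * 1#                         ≈⟨ *-identityʳ _ ⟩
      pow F α (k % d)                              ∎
      where
      division : k ≡ k % d ℕ.+ d ℕ.* (k / d)
      division = ≡.trans (m≡m%n+[m/n]*n k d) (cong (k % d ℕ.+_) (ℕₚ.*-comm (k / d) d))

    pow-nonzero : ¬ α ≈ 0# → ∀ k → ¬ pow F α k ≈ 0#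
    pow-nonzero α≉0 zero    1≈0 = 0≉1 (sym 1≈0)
    pow-nonzero α≉0 (suc k) = nonzero-* α≉0 (pow-nonzero α≉0 k)

    -- Given an enumeration of all m+1 field elements, the m nonzero ones are
    -- enumerated by Fin m (skipping the index of 0).
    module Enumerated {m : ℕ} (e : Fin (suc m) → Carrier)
                      (e-surj : ∀ x → ∃ λ i → e i ≈ x) (e-inj : ∀ i j → e i ≈ e j → i ≡ j) where

      zeroIx : Fin (suc m)
      zeroIx = proj₁ (e-surj 0#)

      nonzeroAt : Fin m → Carrier
      nonzeroAt k = e (punchIn zeroIx k)

      nonzeroAt-nonzero : ∀ k → ¬ nonzeroAt k ≈ 0#
      nonzeroAt-nonzero k k≈0 = punchInᵢ≢i zeroIx k (e-inj _ _ (trans k≈0 (sym (proj₂ (e-surj 0#)))))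

      nonzeroAt-injective : ∀ j k → nonzeroAt j ≈ nonzeroAt k → j ≡ k
      nonzeroAt-injective j k eq = punchIn-injective zeroIx j k (e-inj _ _ eq)

      nonzeroIndex : ∀ y → ¬ y ≈ 0# → Fin m
      nonzeroIndex y y≉0 = punchOut zeroIx≢y
        where
        zeroIx≢y : zeroIx ≢ proj₁ (e-surj y)
        zeroIx≢y eq = y≉0 (trans (sym (proj₂ (e-surj y))) (≡.subst (λ i → e i ≈ 0#) eq (proj₂ (e-surj 0#))))

      nonzeroIndex-spec : ∀ y y≉0 → nonzeroAt (nonzeroIndex y y≉0) ≈ y
      nonzeroIndex-spec y y≉0 = ≡.subst (λ i → e i ≈ y) (≡.sym (punchIn-punchOut _)) (proj₂ (e-surj y))

      -- every nonzero element is a power of α; were α = 0 they would all equal 1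
      α-nonzero : 2 ≤ m → ¬ α ≈ 0#
      α-nonzero 2≤m α≈0 = ≤⇒≯ (injective⇒≤ {f = λ (_ : Fin m) → Fin.zero {0}} collapse) 2≤m
        where
        isOne : ∀ k → nonzeroAt k ≈ 1#
        isOne k with prim (nonzeroAt k) (nonzeroAt-nonzero k)
        ... | zero  , 1≈x = sym 1≈x
        ... | suc n , αⁿ⁺¹≈x = ⊥-elim (nonzeroAt-nonzero k (trans (sym αⁿ⁺¹≈x) (trans (*-cong α≈0 ≈-refl) (zeroˡ _))))
        collapse : Injective _≡_ _≡_ (λ (_ : Fin m) → Fin.zero {0})
        collapse {j} {k} _ = nonzeroAt-injective j k (trans (isOne j) (sym (isOne k)))

      -- if α^d = 1 (d > 0), the residues mod d of the logarithms separate the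
      -- nonzero elements, so there are at most d of them
      order-bound : ∀ d .{{_ : NonZero d}} → pow F α d ≈ 1# → m ≤ d
      order-bound d αᵈ≈1 = injective⇒≤ {f = residue} residue-injective
        where
        log : Fin m → ℕ
        log k = proj₁ (prim (nonzeroAt k) (nonzeroAt-nonzero k))
        log-spec : ∀ k → pow F α (log k % d) ≈ nonzeroAt k
        log-spec k = trans (sym (pow-mod d αᵈ≈1 (log k))) (proj₂ (prim (nonzeroAt k) (nonzeroAt-nonzero k)))
        residue : Fin m → Fin d
        residue k = fromℕ< (m%n<n (log k) d)
        residue-injective : Injective _≡_ _≡_ residue
        residue-injective {j} {k} eq = nonzeroAt-injective j k (begin
          nonzeroAt j           ≈⟨ sym (log-spec j) ⟩
          pow F α (log j % d)   ≡⟨ cong (pow F α) (fromℕ<-injective _ _ (m%n<n (log j) d) (m%n<n (log k) d) eq) ⟩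
          pow F α (log k % d)   ≈⟨ log-spec k ⟩
          nonzeroAt k           ∎)

      -- pigeonhole on α^0, …, α^m (m+1 nonzero values among m): α^d = 1 for some 0 < d ≤ m
      period : ¬ α ≈ 0# → ∃ λ d → 0 < d × d ≤ m × pow F α d ≈ 1#
      period α≉0 with pigeonhole (n<1+n m) (λ (k : Fin (suc m)) → nonzeroIndex (pow F α (toℕ k)) (pow-nonzero α≉0 (toℕ k)))
      ... | i , j , i<j , same = toℕ j ∸ toℕ i , m<n⇒0<n∸m i<j , ≤-trans (m∸n≤m (toℕ j) (toℕ i)) (≤-pred (toℕ<n j)) , αᵈ≈1
        where
        αⁱ = pow F α (toℕ i)
        αⁱ≈αʲ : αⁱ ≈ pow F α (toℕ j)
        αⁱ≈αʲ = trans (sym (nonzeroIndex-spec αⁱ (pow-nonzero α≉0 (toℕ i))))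
                 (≡.subst (λ t → nonzeroAt t ≈ pow F α (toℕ j)) (≡.sym same) (nonzeroIndex-spec _ (pow-nonzero α≉0 (toℕ j))))
        αᵈ≈1 : pow F α (toℕ j ∸ toℕ i) ≈ 1#
        αᵈ≈1 = cancelˡ (pow-nonzero α≉0 (toℕ i)) (begin
          αⁱ * pow F α (toℕ j ∸ toℕ i)         ≈⟨ sym (pow-+ α (toℕ i) _) ⟩
          pow F α (toℕ i ℕ.+ (toℕ j ∸ toℕ i))  ≡⟨ cong (pow F α) (m+[n∸m]≡n (<⇒≤ i<j)) ⟩
          pow F α (toℕ j)                      ≈⟨ sym αⁱ≈αʲ ⟩
          αⁱ                                   ≈⟨ sym (*-identityʳ αⁱ) ⟩
          αⁱ * 1#                              ∎)

      α^m≈1 : ¬ α ≈ 0# → pow F α m ≈ 1#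
      α^m≈1 α≉0 with period α≉0
      ... | d , 0<d , d≤m , αᵈ≈1 = ≡.subst (λ t → pow F α t ≈ 1#) (≤-antisym d≤m (order-bound d {{>-nonZero 0<d}} αᵈ≈1)) αᵈ≈1

    fermat : 3 ≤ size → pow F α (size ∸ 1) ≈ 1#
    fermat = fermat-for size enum enum-surj enum-inj
      where
      fermat-for : ∀ n (e : Fin n → Carrier) → (∀ x → ∃ λ i → e i ≈ x) → (∀ i j → e i ≈ e j → i ≡ j) →
                   3 ≤ n → pow F α (n ∸ 1) ≈ 1#
      fermat-for (suc m) e e-surj e-inj (s≤s 2≤m) = α^m≈1 (α-nonzero 2≤m)
        where open Enumerated e e-surj e-inj

cube-minus-one : ∀ q → (q ∸ 1) ℕ.* ((q ^ 2 + q) + 1) ≡ q ^ 3 ∸ 1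
cube-minus-one zero    = refl
cube-minus-one (suc p) = ≡.sym (cong (_∸ 1) (cube-expand p))
  where
  open +-*-Solver using (solve; _:+_; _:*_; _:^_; con; _:=_)
  cube-expand : ∀ p → suc p ^ 3 ≡ suc (p ℕ.* ((suc p ^ 2 + suc p) + 1))
  cube-expand = solve 1 (λ p → (con 1 :+ p) :^ 3 := con 1 :+ p :* (((con 1 :+ p) :^ 2 :+ (con 1 :+ p)) :+ con 1)) refl

two≤q : ∀ q → q % 4 ≡ 1 → ¬ q % 3 ≡ 1 → 2 ≤ q
two≤q zero          ()  _
two≤q (suc zero)    _   q%3≢1 = ⊥-elim (q%3≢1 refl)
two≤q (suc (suc _)) _   _     = s≤s (s≤s z≤n)

three≤cube : ∀ {q} → 2 ≤ q → 3 ≤ q ^ 3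
three≤cube 2≤q = ≤-trans (s≤s (s≤s (s≤s z≤n))) (^-monoˡ-≤ 3 2≤q)


module QuarticSymmetry {c ℓ : Level} (F : FiniteField c ℓ) (q : ℕ) (α : FiniteField.Carrier F) where
  open FiniteField F renaming (refl to ≈-refl)
  open FieldPowers F using (pow-cong; pow-*)
  open Quartic F q α

  dlog-cong : ∀ {a b} → a ≈ b → dlog a ≡ dlog b
  dlog-cong {a} {b} a≈b =
    cong head (filter-≐ (T? ∘ λ n → ⌊ pow F α n ≟ a ⌋) (T? ∘ λ n → ⌊ pow F α n ≟ b ⌋)
                        ((λ {n} → transport a≈b {n}) , (λ {n} → transport (sym a≈b) {n})) (upTo (size ∸ 1)))
    where
    transport : ∀ {a b} → a ≈ b → ∀ {n} → True (pow F α n ≟ a) → True (pow F α n ≟ b)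
    transport a≈b t = fromWitness (trans (toWitness t) a≈b)

  Tr-cong : ∀ {a b} → a ≈ b → Tr a ≈ Tr b
  Tr-cong a≈b = +-cong (+-cong a≈b (pow-cong q a≈b)) (pow-cong (q ^ 2) a≈b)

  prodExp-reflect : ∀ x {i} → i ≤ N → isExp 1 (prodExp x (N ∸ i)) ≡ isExp 3 (prodExp x i)
  prodExp-reflect x {i} i≤N = ≡.trans
    (cong (λ j → isExp 1 (quotExp (chi4 (Tr (μinv i * x))) (chi4 (Tr (pow F μ j * x))))) (m∸[m∸n]≡n i≤N))
    (quotExp-conj (dlog (Tr (pow F μ i * x))) (dlog (Tr (μinv i * x))))

  -- at the fixed point i = 0 both factors coincide, so the value is 1
  prodExp-zero : pow F μ N ≈ 1# → ∀ x k → isExp (suc k) (prodExp x 0) ≡ false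
  prodExp-zero μᴺ≈1 x k = ≡.trans
    (cong (λ u → isExp (suc k) (quotExp (chi4 (Tr (1# * x))) (reduce u))) (dlog-cong (Tr-cong (*-cong μᴺ≈1 ≈-refl))))
    (quotExp-self k (dlog (Tr (1# * x))))

  kappa-symmetric : pow F μ N ≈ 1# → ∀ x → kappa 1 x ≡ kappa 3 x
  kappa-symmetric μᴺ≈1 x = begin
    kappa 1 x                                  ≡⟨ count-filter (λ i → isExp 1 (prodExp x i)) id N ⟩
    count (λ i → isExp 1 (prodExp x i)) N      ≡⟨ count-reflect N at-zero (λ _ i<N → prodExp-reflect x (<⇒≤ i<N)) ⟩
    count (λ i → isExp 3 (prodExp x i)) N      ≡⟨ count-filter (λ i → isExp 3 (prodExp x i)) id N ⟨
    kappa 3 x                                  ∎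
    where
    open ≡.≡-Reasoning
    at-zero : isExp 1 (prodExp x 0) ≡ isExp 3 (prodExp x 0)
    at-zero = ≡.trans (prodExp-zero μᴺ≈1 x 0) (≡.sym (prodExp-zero μᴺ≈1 x 2))

  -- μ = α^(q-1) has order dividing N, because (q - 1) N = q³ - 1 = |E*|
  μ-order : IsPrimitive F α → size ≡ q ^ 3 → 3 ≤ size → pow F μ N ≈ 1#
  μ-order prim size≡q³ 3≤size = trans (pow-* α (q ∸ 1) N)
    (≡.subst (λ e → pow F α e ≈ 1#) exponent (FieldPowers.Primitive.fermat F α prim 3≤size))
    where
    exponent : size ∸ 1 ≡ (q ∸ 1) ℕ.* N
    exponent = ≡.trans (cong (_∸ 1) size≡q³) (≡.sym (cube-minus-one q))

-- The theorem: q ≥ 2 makes E have at least three elements, Fermat's little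
-- theorem gives μ^N = 1, and the reflection symmetry gives κ_i(x) = κ_{-i}(x).
mainTheorem7 : ∀ {c ℓ : Level} (q : ℕ) → IsPrimePower q → q % 4 ≡ 1 → ¬ (q % 3 ≡ 1) →
                 (F : FiniteField c ℓ) → FiniteField.size F ≡ q ^ 3 →
                 (α : FiniteField.Carrier F) → IsPrimitive F α →
                 (x : FiniteField.Carrier F) → ¬ (FiniteField._≈_ F x (FiniteField.0# F)) →
                 Quartic.kappa F q α 1 x ≡ Quartic.kappa F q α 3 x
mainTheorem7 q _ q%4≡1 q%3≢1 F size≡q³ α prim x _ = kappa-symmetric (μ-order prim size≡q³ 3≤size) x
  where
  open QuarticSymmetry F q α using (kappa-symmetric; μ-order)
  3≤size : 3 ≤ FiniteField.size F
  3≤size = ≡.subst (3 ≤_) (≡.sym size≡q³) (three≤cube (two≤q q q%4≡1 q%3≢1))
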